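{- Let $\phi:\Sigma^*\to\Gamma^*$ be an injective morphism, let $u,v\in\Sigma^*$, and let $k\ge 1$ be an integer. If $\phi$ is interference-free on $\bigcup_{i=0}^{k-1}\{\phi^i(u)\}$, then $\mathrm{occ}(u,v)=\mathrm{occ}(\phi^k(u),\phi^k(v))$.
   Context: $\mathrm{occ}(u,w)$ denotes the number of positions $i$ with $w[i..i+|u|-1]=u$ (occurrences may overlap). $\phi^0(u)=u$, $\phi^i(u)=\phi(\phi^{i-1}(u))$. A morphism satisfies $\phi(uv)=\phi(u)\phi(v)$; its images are $\phi(c)$, $c\in\Sigma$. $\phi$ is injective if $\phi(u)\neq\phi(v)$ for all $u\neq v$. A word admits an image factorization if it is a concatenation of zero or more images. A word $w$ admits an interfered image factorization if $w=xyz$ with $x$ a proper (possibly empty) suffix of some image, $y$ admitting an image factorization, $z$ a proper (possibly empty) prefix of some image, and $xz\neq\varepsilon$. A word is an inner image factor if it is a proper factor of some image $\phi(c)$ that is neither a prefix nor a suffix of $\phi(c)$. For injective $\phi$, $\phi$ is interference-free on $\mathcal{L}\subseteq\Sigma^*$ if for every non-empty $u\in\mathcal{L}$, $\phi(u)$ admits no interfered image factorization and is not an inner image factor. -}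

module Defs where

open import Data.Nat using (ℕ; zero; suc; _+_)
open import Data.Bool using (Bool; true; false; _∧_)
open import Data.Fin using (Fin)
open import Data.Fin.Properties using (_≟_)
open import Data.List using (List; []; _∷_; _++_; concatMap)
open import Data.Product using (Σ; _×_; ∃)
open import Relation.Nullary using (¬_; does)
open import Relation.Binary.PropositionalEquality using (_≡_; _≢_)

Word : ℕ → Set
Word n = List (Fin n)

morph : ∀ {n} → (Fin n → Word n) → Word n → Word n
morph f = concatMap f

iter : ∀ {n} → (Fin n → Word n) → ℕ → Word n → Word n
iter f zero    w = w
iter f (suc i) w = morph f (iter f i w)

isPrefix : ∀ {n} → Word n → Word n → Bool
isPrefix []      w       = true
isPrefix (a ∷ u) []      = false
isPrefix (a ∷ u) (b ∷ w) = does (a ≟ b) ∧ isPrefix u w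

-- occ(u,w): number of positions i (0 ≤ i ≤ |w|) such that u is a prefix
-- of the suffix of w starting at i, i.e. w[i..i+|u|-1] = u (overlaps allowed).
bit : Bool → ℕ
bit true  = 1
bit false = 0

occ : ∀ {n} → Word n → Word n → ℕ
occ u []      = bit (isPrefix u [])
occ u (a ∷ w) = bit (isPrefix u (a ∷ w)) + occ u w

module _ {n : ℕ} (f : Fin n → Word n) where

  ImageFactorization : Word n → Set
  ImageFactorization w = Σ (Word n) λ t → w ≡ morph f t

  ProperSuffixOfImage : Word n → Set
  ProperSuffixOfImage x = Σ (Fin n) λ c → Σ (Word n) λ p → p ≢ [] × p ++ x ≡ f c

  ProperPrefixOfImage : Word n → Set
  ProperPrefixOfImage z = Σ (Fin n) λ c → Σ (Word n) λ s → s ≢ [] × z ++ s ≡ f c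

  InterferedImageFactorization : Word n → Set
  InterferedImageFactorization w =
    Σ (Word n) λ x → Σ (Word n) λ y → Σ (Word n) λ z →
      (w ≡ x ++ y ++ z) × ProperSuffixOfImage x × ImageFactorization y
        × ProperPrefixOfImage z × (x ++ z ≢ [])

  InnerImageFactor : Word n → Set
  InnerImageFactor w = Σ (Fin n) λ c →
    (Σ (Word n) λ p → Σ (Word n) λ s → p ++ w ++ s ≡ f c)
    × (w ≢ f c)
    × ¬ (Σ (Word n) λ s → w ++ s ≡ f c)
    × ¬ (Σ (Word n) λ p → p ++ w ≡ f c)

  InterferenceFree : (Word n → Set) → Set
  InterferenceFree L = ∀ u → L u → u ≢ [] →
    ¬ InterferedImageFactorization (morph f u) × ¬ InnerImageFactor (morph f u)

{-# OPTIONS --safe #-}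
module Submission where

-- Write U = φ(u). An occurrence of U in φ(v) cannot start strictly inside an
-- image φ(a): if it ends inside φ(a), U is an inner image factor or a proper
-- suffix of φ(a); if it runs past φ(a), it exhibits an interfered image
-- factorization of U. So occurrences of U in φ(v) start at image boundaries,
-- and by injectivity U is a prefix of φ(a v') exactly when u is a prefix of
-- a v'. Hence occ(u, v) = occ(φ(u), φ(v)), and iterating this for
-- φ⁰(u), …, φ^(k-1)(u) gives the theorem.

open import Defs
open import Data.Nat using (ℕ; zero; suc; _+_; _≤_; _<_; s≤s)
open import Data.Nat.Properties using (≤-refl; <⇒≤; <⇒≢; m≤m+n; m≤n+m; module ≤-Reasoning)
open import Data.Fin using (Fin)
open import Data.Fin.Properties using (_≟_)
open import Data.List using (List; []; _∷_; _++_; [_]; length)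
open import Data.List.Properties
  using (++-assoc; ++-identityʳ; ++-conicalˡ; length-++; ∷-injectiveˡ; ∷-injectiveʳ; concatMap-++)
open import Data.Product using (Σ; ∃; ∃₂; _×_; _,_; proj₁; proj₂)
open import Data.Sum using (_⊎_; inj₁; inj₂)
open import Data.Bool using (false)
open import Data.Empty using (⊥-elim)
open import Function using (_∘_)
open import Function.Definitions using (Injective)
open import Relation.Nullary using (¬_; yes; no; _because_; proof)
open import Relation.Nullary.Decidable using (map′)
open import Relation.Nullary.Reflects using (Reflects; ofʸ; ofⁿ; det)
open import Relation.Binary.PropositionalEquality using (_≡_; _≢_; refl; sym; trans; cong; cong₂; module ≡-Reasoning)

module _ {A : Set} where

  ++-equidivisible : ∀ (a b c d : List A) → a ++ b ≡ c ++ d →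
    (∃ λ m → c ≡ a ++ m × b ≡ m ++ d) ⊎ (∃₂ λ x m → a ≡ c ++ x ∷ m × d ≡ x ∷ m ++ b)
  ++-equidivisible []      b c       d eq = inj₁ (c , refl , eq)
  ++-equidivisible (x ∷ a) b []      d eq = inj₂ (x , a , refl , sym eq)
  ++-equidivisible (x ∷ a) b (y ∷ c) d eq
    with ∷-injectiveˡ eq | ++-equidivisible a b c d (∷-injectiveʳ eq)
  ... | refl | inj₁ (m , c≡a++m , b≡m++d) = inj₁ (m , cong (x ∷_) c≡a++m , b≡m++d)
  ... | refl | inj₂ (z , m , a≡c++zm , d≡zm++b) = inj₂ (z , m , cong (x ∷_) a≡c++zm , d≡zm++b)

  xs≢ys++xs++zs : ∀ (xs ys zs : List A) → ys ≢ [] → xs ≢ ys ++ xs ++ zs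
  xs≢ys++xs++zs xs []       zs []≢[] _  = []≢[] refl
  xs≢ys++xs++zs xs (y ∷ ys) zs _     eq = <⇒≢ (s≤s xs≤) (cong length eq)
    where
    open ≤-Reasoning
    xs≤ : length xs ≤ length (ys ++ xs ++ zs)
    xs≤ = begin
      length xs                       ≤⟨ m≤m+n _ _ ⟩
      length xs + length zs           ≡⟨ length-++ xs ⟨
      length (xs ++ zs)               ≤⟨ m≤n+m _ _ ⟩
      length ys + length (xs ++ zs)   ≡⟨ length-++ ys ⟨
      length (ys ++ xs ++ zs)         ∎

module _ {n : ℕ} where

  _⊑_ : Word n → Word n → Set
  u ⊑ w = ∃ λ s → w ≡ u ++ s

  isPrefix-reflects : ∀ (u w : Word n) → Reflects (u ⊑ w) (isPrefix u w)
  isPrefix-reflects []      w       = ofʸ (w , refl)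
  isPrefix-reflects (a ∷ u) []      = ofⁿ λ ()
  isPrefix-reflects (a ∷ u) (b ∷ w) with a ≟ b | isPrefix u w | isPrefix-reflects u w
  ... | no a≢b  | _ | _             = ofⁿ λ (_ , eq) → a≢b (sym (∷-injectiveˡ eq))
  ... | yes refl | _ | ofʸ (s , eq) = ofʸ (s , cong (a ∷_) eq)
  ... | yes refl | _ | ofⁿ u⋢w      = ofⁿ λ (s , eq) → u⋢w (s , ∷-injectiveʳ eq)

  isPrefix-cong : ∀ {u w u′ w′ : Word n} → (u′ ⊑ w′ → u ⊑ w) → (u ⊑ w → u′ ⊑ w′) →
    isPrefix u w ≡ isPrefix u′ w′
  isPrefix-cong {u} {w} {u′} {w′} to from =
    det (isPrefix-reflects u w) (proof (map′ to from (isPrefix u′ w′ because isPrefix-reflects u′ w′)))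

  ⋢⇒isPrefix≡false : ∀ {u w : Word n} → ¬ (u ⊑ w) → isPrefix u w ≡ false
  ⋢⇒isPrefix≡false {u} {w} u⋢w = det (isPrefix-reflects u w) (ofⁿ u⋢w)

module _ {n : ℕ} (f : Fin n → Word n) where

  private
    φ : Word n → Word n
    φ = morph f

  []-properPrefixOfImage : ∀ c → f c ≢ [] → ProperPrefixOfImage f []
  []-properPrefixOfImage c fc≢[] = c , f c , fc≢[] , refl

  []-properSuffixOfImage : ∀ c → f c ≢ [] → ProperSuffixOfImage f []
  []-properSuffixOfImage c fc≢[] = c , f c , fc≢[] , ++-identityʳ (f c)

  ⊑-morph : ∀ {u v : Word n} → u ⊑ v → φ u ⊑ φ v
  ⊑-morph {u} (s , refl) = φ s , concatMap-++ f u s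

  prefix-of-image : ∀ v (w s : Word n) → φ v ≡ w ++ s →
      (∃₂ λ t r → v ≡ t ++ r × w ≡ φ t)
    ⊎ (∃₂ λ t z → w ≡ φ t ++ z × ProperPrefixOfImage f z × z ≢ [])
  prefix-of-image v       []          s _  = inj₁ ([] , v , refl , refl)
  prefix-of-image []      (_ ∷ _)     s ()
  prefix-of-image (c ∷ v) w@(_ ∷ _)   s eq with ++-equidivisible (f c) (φ v) w s eq
  ... | inj₂ (x , m , fc≡w++xm , _) = inj₂ ([] , w , refl , (c , x ∷ m , (λ ()) , sym fc≡w++xm) , λ ())
  ... | inj₁ (m , w≡fc++m , φv≡m++s) with prefix-of-image v m s φv≡m++s
  ...   | inj₁ (t , r , v≡t++r , m≡φt) =
          inj₁ (c ∷ t , r , cong (c ∷_) v≡t++r , trans w≡fc++m (cong (f c ++_) m≡φt))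
  ...   | inj₂ (t , z , m≡φt++z , z-prefix , z≢[]) =
          inj₂ (c ∷ t , z , w≡φct++z , z-prefix , z≢[])
    where
    w≡φct++z : w ≡ φ (c ∷ t) ++ z
    w≡φct++z = trans w≡fc++m (trans (cong (f c ++_) m≡φt++z) (sym (++-assoc (f c) (φ t) z)))

  module _ {w : Word n} (w≢[] : w ≢ []) (¬iif : ¬ InterferedImageFactorization f w) where

    offset-occurrence⇒InnerImageFactor : ∀ {a} {p s : Word n} → p ≢ [] → p ++ w ++ s ≡ f a →
      InnerImageFactor f w
    offset-occurrence⇒InnerImageFactor {a} {p} {s} p≢[] p++w++s≡fa =
      a , (p , s , p++w++s≡fa) , w≢fa , ¬prefix , ¬suffix
      where
      fa≢[] : f a ≢ []
      fa≢[] = p≢[] ∘ ++-conicalˡ p (w ++ s) ∘ trans p++w++s≡fa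
      w≢fa : w ≢ f a
      w≢fa w≡fa = xs≢ys++xs++zs w p s p≢[] (trans w≡fa (sym p++w++s≡fa))
      ¬prefix : ¬ (∃ λ s′ → w ++ s′ ≡ f a)
      ¬prefix ([]     , w++[]≡fa) = w≢fa (trans (sym (++-identityʳ w)) w++[]≡fa)
      ¬prefix (x ∷ s′ , w++s′≡fa) =
        ¬iif ([] , [] , w , refl , []-properSuffixOfImage a fa≢[] , ([] , refl) ,
              (a , x ∷ s′ , (λ ()) , w++s′≡fa) , w≢[])
      ¬suffix : ¬ (∃ λ p′ → p′ ++ w ≡ f a)
      ¬suffix ([]     , w≡fa)     = w≢fa w≡fa
      ¬suffix (x ∷ p′ , p′++w≡fa) =
        ¬iif (w , [] , [] , sym (++-identityʳ w) , (a , x ∷ p′ , (λ ()) , p′++w≡fa) , ([] , refl) ,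
              []-properPrefixOfImage a fa≢[] , w≢[] ∘ ++-conicalˡ w [])

    module _ (¬inner : ¬ InnerImageFactor f w) where

      ⋢-suffix++image : ∀ {q} v → ProperSuffixOfImage f q → q ≢ [] → ¬ (w ⊑ (q ++ φ v))
      ⋢-suffix++image {q} v q-suffix@(a , p , p≢[] , p++q≡fa) q≢[] (s , q++φv≡w++s)
        with ++-equidivisible q (φ v) w s q++φv≡w++s
      ... | inj₂ (x , m , q≡w++xm , _) =
            ¬inner (offset-occurrence⇒InnerImageFactor p≢[] (trans (cong (p ++_) (sym q≡w++xm)) p++q≡fa))
      ... | inj₁ (m , w≡q++m , φv≡m++s) with prefix-of-image v m s φv≡m++s
      ...   | inj₁ (t , _ , _ , m≡φt) =
              ¬iif (q , φ t , [] , trans w≡q++m (cong (q ++_) (trans m≡φt (sym (++-identityʳ (φ t))))) ,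
                    q-suffix , (t , refl) , []-properPrefixOfImage a fa≢[] , q≢[] ∘ ++-conicalˡ q [])
        where
        fa≢[] : f a ≢ []
        fa≢[] = p≢[] ∘ ++-conicalˡ p q ∘ trans p++q≡fa
      ...   | inj₂ (t , z , m≡φt++z , z-prefix , _) =
              ¬iif (q , φ t , z , trans w≡q++m (cong (q ++_) m≡φt++z) ,
                    q-suffix , (t , refl) , z-prefix , q≢[] ∘ ++-conicalˡ q z)

      occ-suffix++image : ∀ {q} v → ProperSuffixOfImage f q → occ w (q ++ φ v) ≡ occ w (φ v)
      occ-suffix++image {[]}    v _ = refl
      occ-suffix++image {x ∷ q} v xq-suffix@(a , p , p≢[] , p++xq≡fa) =
        cong₂ _+_ (cong bit (⋢⇒isPrefix≡false (⋢-suffix++image v xq-suffix (λ ()))))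
                  (occ-suffix++image v q-suffix)
        where
        q-suffix : ProperSuffixOfImage f q
        q-suffix = a , p ++ [ x ] , p≢[] ∘ ++-conicalˡ p [ x ] , trans (++-assoc p [ x ] q) p++xq≡fa

      occ-morph-∷ : ∀ a v → f a ≢ [] → occ w (φ (a ∷ v)) ≡ bit (isPrefix w (φ (a ∷ v))) + occ w (φ v)
      occ-morph-∷ a v fa≢[] with f a in fa≡
      ... | []    = ⊥-elim (fa≢[] refl)
      ... | x ∷ q = cong (bit (isPrefix w (x ∷ q ++ φ v)) +_) (occ-suffix++image v (a , [ x ] , (λ ()) , sym fa≡))

  module _ (inj : Injective _≡_ _≡_ φ) where

    morph-≢[] : ∀ {u : Word n} → u ≢ [] → φ u ≢ []
    morph-≢[] u≢[] = u≢[] ∘ inj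

    image-≢[] : ∀ c → f c ≢ []
    image-≢[] c = morph-≢[] {c ∷ []} (λ ()) ∘ trans (++-identityʳ (f c))

    ⊑-morph-reflect : ∀ {u v : Word n} → ¬ InterferedImageFactorization f (φ u) → φ u ⊑ φ v → u ⊑ v
    ⊑-morph-reflect {u} {v} ¬iif (s , φv≡φu++s) with prefix-of-image v (φ u) s φv≡φu++s
    ... | inj₁ (t , r , v≡t++r , φu≡φt) = r , trans v≡t++r (cong (_++ r) (sym (inj φu≡φt)))
    ... | inj₂ (t , z , φu≡φt++z , z-prefix@(c , _ , _ , _) , z≢[]) =
          ⊥-elim (¬iif ([] , φ t , z , φu≡φt++z , []-properSuffixOfImage c (image-≢[] c) ,
                        (t , refl) , z-prefix , z≢[]))

    occ-morph : ∀ {u : Word n} → InterferenceFree f (_≡ u) → u ≢ [] → ∀ v → occ u v ≡ occ (φ u) (φ v)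
    occ-morph {u} free u≢[] = go
      where
      ¬iif : ¬ InterferedImageFactorization f (φ u)
      ¬iif = proj₁ (free u refl u≢[])
      ¬inner : ¬ InnerImageFactor f (φ u)
      ¬inner = proj₂ (free u refl u≢[])
      isPrefix-morph : ∀ v → isPrefix u v ≡ isPrefix (φ u) (φ v)
      isPrefix-morph v = isPrefix-cong (⊑-morph-reflect {u} {v} ¬iif) (⊑-morph {u} {v})
      open ≡-Reasoning
      go : ∀ v → occ u v ≡ occ (φ u) (φ v)
      go []      = cong bit (isPrefix-morph [])
      go (a ∷ v) = begin
        bit (isPrefix u (a ∷ v)) + occ u v
          ≡⟨ cong₂ _+_ (cong bit (isPrefix-morph (a ∷ v))) (go v) ⟩
        bit (isPrefix (φ u) (φ (a ∷ v))) + occ (φ u) (φ v)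
          ≡⟨ occ-morph-∷ (morph-≢[] u≢[]) ¬iif ¬inner a v (image-≢[] a) ⟨
        occ (φ u) (φ (a ∷ v)) ∎

theorem23 : ∀ {n : ℕ} (f : Fin n → Word n) →
    Injective _≡_ _≡_ (morph f) →
    (u v : Word n) (k : ℕ) → 1 ≤ k → u ≢ [] →
    InterferenceFree f (λ w → Σ ℕ λ i → i < k × w ≡ iter f i u) →
    occ u v ≡ occ (iter f k u) (iter f k v)
theorem23 f inj u v k _ u≢[] free = occ-iter k ≤-refl
  where
  iter-≢[] : ∀ i → iter f i u ≢ []
  iter-≢[] zero    = u≢[]
  iter-≢[] (suc i) = morph-≢[] f inj (iter-≢[] i)
  occ-iter : ∀ i → i ≤ k → occ u v ≡ occ (iter f i u) (iter f i v)
  occ-iter zero    _   = refl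
  occ-iter (suc i) i<k = trans (occ-iter i (<⇒≤ i<k))
    (occ-morph f inj (λ w w≡ → free w (i , i<k , w≡)) (iter-≢[] i) (iter f i v))
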